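{- Let $\mathcal{P}$ be a natural unit interval order on $[1,n]$ and let $V\subseteq\mathfrak{S}_n$ be closed under $\mathcal{P}$-Knuth moves. Then the $\mathcal{P}$-Knuth equivalence graph $\Gamma_V=(V,\mathrm{des}_\mathcal{P},\{E_i\}_{1<i<n})$ is a D graph.
   Context: A natural unit interval order on $[1,n]$ is a partial order $\prec$ with (i) $a\prec b\Rightarrow a<b$, and (ii) if $b\prec c$ and $a$ is incomparable to both $b,c$ then $b<a<c$. $\mathcal{P}$-Knuth moves on words: for $a<b<c$ with $a\prec c$, replace three consecutive letters as follows: (1) $a,b$ incomparable and $b,c$ incomparable: $bca\leftrightarrow cab$; (2) $a\prec b$, $b,c$ incomparable: $bca\leftrightarrow bac$, $cba\leftrightarrow cab$; (3) $a,b$ incomparable, $b\prec c$: $bca\leftrightarrow cba$, $acb\leftrightarrow cab$; (4) $a\prec b\prec c$: $bca\leftrightarrow bac$, $acb\leftrightarrow cab$. If the three letters occupy positions $i-1,i,i+1$, the move is said to occur at position $i$. $\mathrm{des}_\mathcal{P}(w)=\{j\in[1,n-1]: w_{j+1}\prec w_j\}$. The graph $\Gamma_V$ has vertex set $V$, signature function $\mathrm{des}_\mathcal{P}:V\to 2^{[1,n-1]}$, and $E_i$ is the set of unordered pairs in $V$ connected by a $\mathcal{P}$-Knuth move at position $i$. A signed colored graph of degree $n$ is $(V,\sigma,\{E_i\}_{1<i<n})$ with $\sigma:V\to2^{[1,n-1]}$ and each $E_i$ a set of unordered pairs of distinct vertices. It is a D graph if: (Ax1) for $w\in V$ and $1<i<n$,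 $|\sigma(w)\cap\{i-1,i\}|=1$ iff there is $x\in V$ with $\{w,x\}\in E_i$, and such $x$ is unique when it exists; (Ax2) whenever $\{w,x\}\in E_i$, $\sigma(w)\cap\{i\}\ne\sigma(x)\cap\{i\}$ and $\sigma(w)\cap\{h\}=\sigma(x)\cap\{h\}$ for $h\notin[i-2,i+1]$; (Ax3) for $\{w,x\}\in E_i$, if $\sigma(w)\cap\{i-2\}\ne\sigma(x)\cap\{i-2\}$ then $|\sigma(w)\cap\{i-2,i-1\}|=1$, and if $\sigma(w)\cap\{i+1\}\ne\sigma(x)\cap\{i+1\}$ then $|\sigma(w)\cap\{i,i+1\}|=1$; (Ax5) whenever $|i-j|\ge3$, $\{w,x\}\in E_i$ and $\{x,y\}\in E_j$, there is $v\in V$ with $\{w,v\}\in E_j$ and $\{v,y\}\in E_i$. -}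

module Defs where

open import Data.Nat as ℕ using (ℕ; zero; suc; _+_; _∸_)
open import Data.Fin as Fin using (Fin)
open import Data.Bool using (Bool; true; false; T; _xor_)
open import Data.List using (List; []; _∷_; _++_; length; allFin)
open import Data.List.Relation.Binary.Permutation.Propositional using (_↭_)
open import Data.Product using (Σ; _×_; _,_; ∃)
open import Data.Sum using (_⊎_)
open import Relation.Nullary using (¬_)
open import Relation.Binary.PropositionalEquality using (_≡_; _≢_)

-- Letters of [1,n] are represented by Fin n (letter k+1 ↔ Fin k; the
-- usual order < on Fin n is the usual order on [1,n]).

record NUIO (n : ℕ) : Set where
  field
    rel : Fin n → Fin n → Bool

  _≺_ : Fin n → Fin n → Set
  a ≺ b = T (rel a b)

  Incomparable : Fin n → Fin n → Set
  Incomparable a b = ¬ (a ≺ b) × ¬ (b ≺ a)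

  field
    -- partial order (strict): transitive; irreflexivity follows from (i)
    ≺-trans : ∀ {a b c} → a ≺ b → b ≺ c → a ≺ c
    -- (i)
    ≺⇒< : ∀ {a b} → a ≺ b → a Fin.< b
    natural : ∀ {a b c} → b ≺ c → Incomparable a b → Incomparable a c →
              (b Fin.< a) × (a Fin.< c)

open NUIO public using (_≺_; Incomparable)

Word : ℕ → Set
Word n = List (Fin n)

-- Basic P-Knuth moves on three letters (one direction of each ↔).
-- Every constructor assumes a < b < c and a ≺ c.
data BasicMove {n : ℕ} (P : NUIO n) : Word n → Word n → Set where
  m1   : ∀ {a b c} → a Fin.< b → b Fin.< c → _≺_ P a c →
         Incomparable P a b → Incomparable P b c →
         BasicMove P (b ∷ c ∷ a ∷ []) (c ∷ a ∷ b ∷ [])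
  m2a  : ∀ {a b c} → a Fin.< b → b Fin.< c → _≺_ P a c →
         _≺_ P a b → Incomparable P b c →
         BasicMove P (b ∷ c ∷ a ∷ []) (b ∷ a ∷ c ∷ [])
  m2b  : ∀ {a b c} → a Fin.< b → b Fin.< c → _≺_ P a c →
         _≺_ P a b → Incomparable P b c →
         BasicMove P (c ∷ b ∷ a ∷ []) (c ∷ a ∷ b ∷ [])
  m3a  : ∀ {a b c} → a Fin.< b → b Fin.< c → _≺_ P a c →
         Incomparable P a b → _≺_ P b c →
         BasicMove P (b ∷ c ∷ a ∷ []) (c ∷ b ∷ a ∷ [])
  m3b  : ∀ {a b c} → a Fin.< b → b Fin.< c → _≺_ P a c →
         Incomparable P a b → _≺_ P b c →
         BasicMove P (a ∷ c ∷ b ∷ []) (c ∷ a ∷ b ∷ [])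
  m4a  : ∀ {a b c} → a Fin.< b → b Fin.< c → _≺_ P a c →
         _≺_ P a b → _≺_ P b c →
         BasicMove P (b ∷ c ∷ a ∷ []) (b ∷ a ∷ c ∷ [])
  m4b  : ∀ {a b c} → a Fin.< b → b Fin.< c → _≺_ P a c →
         _≺_ P a b → _≺_ P b c →
         BasicMove P (a ∷ c ∷ b ∷ []) (c ∷ a ∷ b ∷ [])

Move3 : {n : ℕ} → NUIO n → Word n → Word n → Set
Move3 P t t' = BasicMove P t t' ⊎ BasicMove P t' t

-- w and x are connected by a P-Knuth move at position i (1-indexed):
-- the three letters replaced occupy positions i-1, i, i+1.
KnuthAt : {n : ℕ} → NUIO n → ℕ → Word n → Word n → Set
KnuthAt P i w x =
  Σ (Word _) λ u → Σ (Word _) λ v → Σ (Word _) λ t → Σ (Word _) λ t' →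
    (w ≡ u ++ t ++ v) × (x ≡ u ++ t' ++ v) × (i ≡ length u + 2) × Move3 P t t'

-- des_P(w) = { j ∈ [1,n-1] : w_{j+1} ≺ w_j }, as a Boolean indicator on ℕ.
des0 : {n : ℕ} → NUIO n → Word n → ℕ → Bool
des0 P (a ∷ b ∷ w) zero    = NUIO.rel P b a
des0 P (a ∷ w)     (suc k) = des0 P w k
des0 P _           _       = false

desP : {n : ℕ} → NUIO n → Word n → ℕ → Bool
desP P w zero    = false
desP P w (suc k) = des0 P w k

InSn : (n : ℕ) → Word n → Set
InSn n w = w ↭ allFin n

ClosedUnderKnuth : {n : ℕ} → NUIO n → (Word n → Set) → Set
ClosedUnderKnuth P V = ∀ i w x → V w → KnuthAt P i w x → V x

record SignedColoredGraph : Set₁ where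
  field
    Carrier : Set
    inV     : Carrier → Set
    deg     : ℕ
    σ       : Carrier → ℕ → Bool
    E       : ℕ → Carrier → Carrier → Set

IsSignedColoredGraph : SignedColoredGraph → Set
IsSignedColoredGraph G =
  (∀ w j → inV w → σ w j ≡ true → (1 ℕ.≤ j) × (j ℕ.≤ deg ∸ 1)) ×
  (∀ i w x → E i w x →
     inV w × inV x × (w ≢ x) × (1 ℕ.< i) × (i ℕ.< deg)) ×
  (∀ i w x → E i w x → E i x w)   -- unordered pairs
  where open SignedColoredGraph G

Ax1 Ax2 Ax3 Ax5 : SignedColoredGraph → Set
Ax1 G = ∀ w i → inV w → 1 ℕ.< i → i ℕ.< deg →
  (((σ w (i ∸ 1) xor σ w i) ≡ true → ∃ λ x → inV x × E i w x) ×
   ((∃ λ x → inV x × E i w x) → (σ w (i ∸ 1) xor σ w i) ≡ true)) ×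
  (∀ x y → E i w x → E i w y → x ≡ y)
  where open SignedColoredGraph G
Ax2 G = ∀ i w x → E i w x →
  (σ w i ≢ σ x i) ×
  (∀ h → (h ℕ.< i ∸ 2 ⊎ i + 1 ℕ.< h) → σ w h ≡ σ x h)
  where open SignedColoredGraph G
Ax3 G = ∀ i w x → E i w x →
  (σ w (i ∸ 2) ≢ σ x (i ∸ 2) → (σ w (i ∸ 2) xor σ w (i ∸ 1)) ≡ true) ×
  (σ w (i + 1) ≢ σ x (i + 1) → (σ w i xor σ w (i + 1)) ≡ true)
  where open SignedColoredGraph G
Ax5 G = ∀ i j w x y → (i + 3 ℕ.≤ j ⊎ j + 3 ℕ.≤ i) → E i w x → E j x y →
  ∃ λ v → inV v × E j w v × E i v y
  where open SignedColoredGraph G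

IsDGraph : SignedColoredGraph → Set
IsDGraph G = IsSignedColoredGraph G × Ax1 G × Ax2 G × Ax3 G × Ax5 G

Γ : {n : ℕ} → NUIO n → (Word n → Set) → SignedColoredGraph
Γ {n} P V = record
  { Carrier = Word n
  ; inV     = V
  ; deg     = n
  ; σ       = desP P
  ; E       = λ i w x → V w × V x × (1 ℕ.< i) × (i ℕ.< n) × KnuthAt P i w x
  }

-- A natural unit interval order satisfies x < y ≺ z ⇒ x ≺ z and x ≺ y < z ⇒ x ≺ z (a letter
-- incomparable to both ends of y ≺ z lies strictly between them). Every P-Knuth move is a basic
-- move read forwards or backwards, and the basic moves are oriented: the source window descends
-- only at its second position (i), the target only at its first (i-1), and the first and last
-- letters can only grow. Hence a move at i flips the descent at i, leaves descents away from the
-- window alone, and, by the two transitivity laws, changes the boundary descents at i-2 and i+1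
-- only in the way Ax3 allows. Conversely a window of distinct letters with exactly one descent is
-- the source or the target of exactly one basic move, found by comparing its three letters; Ax5
-- holds because moves on disjoint windows commute.

module Submission where

open import Defs hiding (_≺_; Incomparable)
open import Data.Bool using (Bool; true; false; T; _xor_; if_then_else_)
open import Data.Bool.Properties using (T-≡)
open import Data.Empty using (⊥-elim)
open import Data.Fin as Fin using (Fin)
open import Data.Fin.Properties using (<-trans; <-asym; <-cmp)
open import Data.List using (List; []; _∷_; _++_; length)
open import Data.List.Properties using (++-assoc; length-++; length-tabulate; ∷-injective)
open import Data.List.Relation.Binary.Permutation.Propositional using (↭-sym; ↭⇒↭ₛ)
open import Data.List.Relation.Binary.Permutation.Propositional.Properties using (↭-length)
open import Data.List.Relation.Binary.Permutation.Setoid.Properties using (Unique-resp-↭)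
open import Data.List.Relation.Unary.AllPairs using ([]; _∷_)
open import Data.List.Relation.Unary.All using ([]; _∷_)
open import Data.List.Relation.Unary.Unique.Propositional using (Unique)
open import Data.List.Relation.Unary.Unique.Propositional.Properties using (allFin⁺)
open import Data.Nat using (ℕ; zero; suc; _+_; _∸_; _≤_; _<_; z≤n; s≤s; s≤s⁻¹)
open import Data.Nat.Properties
  using (module ≤-Reasoning; +-comm; +-suc; +-identityʳ; +-assoc; +-cancelʳ-≡; +-cancelʳ-≤;
         suc-injective; ∸-monoˡ-≤)
open import Data.Product using (_×_; _,_; -,_; ∃; proj₁; proj₂)
open import Data.Sum using (_⊎_; inj₁; inj₂)
import Data.Sum as Sum
open import Function using (id)
open import Function.Bundles using (Equivalence)
open import Relation.Binary.Definitions using (tri<; tri≈; tri>)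
open import Relation.Binary.PropositionalEquality
  using (_≡_; _≢_; refl; sym; trans; cong; cong₂; subst; subst₂; setoid; ≢-sym; module ≡-Reasoning)
open import Relation.Nullary using (¬_; yes; no)
open import Relation.Nullary.Decidable using (T?)

private variable
  A : Set
  a b : Bool

¬T⇒≡false : ¬ T a → a ≡ false
¬T⇒≡false {true}  ¬a = ⊥-elim (¬a _)
¬T⇒≡false {false} ¬a = refl

T-mono-≢ : (T a → T b) → a ≢ b → a ≡ false × b ≡ true
T-mono-≢ {false} {true}  _   _   = refl , refl
T-mono-≢ {false} {false} _   a≢b = ⊥-elim (a≢b refl)
T-mono-≢ {true}  {true}  _   a≢b = ⊥-elim (a≢b refl)
T-mono-≢ {true}  {false} a⇒b _   = ⊥-elim (a⇒b _)

++-cancel-length : ∀ (u u' : List A) {r r'} →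
                   length u ≡ length u' → u ++ r ≡ u' ++ r' → u ≡ u' × r ≡ r'
++-cancel-length []      []        _   eq = refl , eq
++-cancel-length (a ∷ u) (a' ∷ u') len eq with ∷-injective eq
... | refl , eq' with ++-cancel-length u u' (suc-injective len) eq'
...   | refl , r≡r' = refl , r≡r'

++-split-≤ : ∀ (a b c d : List A) → a ++ b ≡ c ++ d → length a ≤ length c →
             ∃ λ m → c ≡ a ++ m × b ≡ m ++ d
++-split-≤ []      b c       d eq _         = c , refl , eq
++-split-≤ (x ∷ a) b (y ∷ c) d eq (s≤s len) with ∷-injective eq
... | refl , eq' with ++-split-≤ a b c d eq' len
...   | m , refl , b≡ = m , refl , b≡

++-assoc₃ : ∀ (a b c d : List A) → a ++ b ++ c ++ d ≡ (a ++ b ++ c) ++ d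
++-assoc₃ a b c d = sym (trans (++-assoc a (b ++ c) d) (cong (a ++_) (++-assoc b c d)))

length-++-≡ : ∀ (u r : List A) {t t'} → length t ≡ length t' →
              length ((u ++ t) ++ r) ≡ length (u ++ t' ++ r)
length-++-≡ u r {t} {t'} len = begin
  length ((u ++ t) ++ r)            ≡⟨ length-++ (u ++ t) ⟩
  length (u ++ t) + length r        ≡⟨ cong (_+ length r) (length-++ u) ⟩
  length u + length t + length r    ≡⟨ cong (λ l → length u + l + length r) len ⟩
  length u + length t' + length r   ≡⟨ +-assoc (length u) (length t') (length r) ⟩
  length u + (length t' + length r) ≡⟨ cong (length u +_) (length-++ t') ⟨
  length u + length (t' ++ r)       ≡⟨ length-++ u ⟨
  length (u ++ t' ++ r)             ∎
  where open ≡-Reasoning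

window-before : ∀ (u t : List A) {m} → length t ≡ 3 → length u + 2 + 3 ≤ m + 2 →
                length (u ++ t) ≤ m
window-before u t {m} len le = begin
  length (u ++ t)     ≡⟨ length-++ u ⟩
  length u + length t ≡⟨ cong (length u +_) len ⟩
  length u + 3        ≤⟨ +-cancelʳ-≤ 2 (length u + 3) m (subst (_≤ m + 2) (+-2-3 (length u)) le) ⟩
  m                   ∎
  where
  open ≤-Reasoning
  +-2-3 : ∀ l → l + 2 + 3 ≡ l + 3 + 2
  +-2-3 l = trans (+-assoc l 2 3) (sym (+-assoc l 3 2))

module _ {n : ℕ} (P : NUIO n) where
  open NUIO P

  private variable
    x y z : Fin n
    t t' : Word n

  <⇒⊁ : x Fin.< y → ¬ y ≺ x
  <⇒⊁ x<y y≺x = <-asym x<y (≺⇒< y≺x)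

  <-≺-trans : x Fin.< y → y ≺ z → x ≺ z
  <-≺-trans {x} {y} {z} x<y y≺z with T? (rel x y) | T? (rel x z) | T? (rel z x)
  ... | yes x≺y | _       | _       = ≺-trans x≺y y≺z
  ... | no _    | yes x≺z | _       = x≺z
  ... | no _    | no _    | yes z≺x = ⊥-elim (<-asym x<y (≺⇒< (≺-trans y≺z z≺x)))
  ... | no x⊀y  | no x⊀z  | no z⊀x  =
    ⊥-elim (<-asym x<y (proj₁ (natural y≺z (x⊀y , <⇒⊁ x<y) (x⊀z , z⊀x))))

  ≺-<-trans : x ≺ y → y Fin.< z → x ≺ z
  ≺-<-trans {x} {y} {z} x≺y y<z with T? (rel y z) | T? (rel x z) | T? (rel z x)
  ... | yes y≺z | _       | _       = ≺-trans x≺y y≺z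
  ... | no _    | yes x≺z | _       = x≺z
  ... | no _    | no _    | yes z≺x = ⊥-elim (<-asym y<z (≺⇒< (≺-trans z≺x x≺y)))
  ... | no y⊀z  | no x⊀z  | no z⊀x  =
    ⊥-elim (<-asym y<z (proj₂ (natural x≺y (z⊀x , x⊀z) (<⇒⊁ y<z , y⊀z))))

  ≺⇒rel : x ≺ y → rel x y ≡ true
  ≺⇒rel = Equivalence.to T-≡

  rel⇒≺ : rel x y ≡ true → x ≺ y
  rel⇒≺ = Equivalence.from T-≡

  ⊀⇒rel : ¬ x ≺ y → rel x y ≡ false
  ⊀⇒rel = ¬T⇒≡false

  des0-cons : ∀ a (w : Word n) k → des0 P (a ∷ w) (suc k) ≡ des0 P w k
  des0-cons a []      k = refl
  des0-cons a (b ∷ w) k = refl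

  des0-< : x Fin.< y → ∀ v → T (des0 P (x ∷ v) 0) → T (des0 P (y ∷ v) 0)
  des0-< x<y []      ()
  des0-< x<y (e ∷ v) e≺x = ≺-<-trans e≺x x<y

  BasicMove-length : BasicMove P t t' → length t ≡ 3 × length t' ≡ 3
  BasicMove-length (m1  _ _ _ _ _) = refl , refl
  BasicMove-length (m2a _ _ _ _ _) = refl , refl
  BasicMove-length (m2b _ _ _ _ _) = refl , refl
  BasicMove-length (m3a _ _ _ _ _) = refl , refl
  BasicMove-length (m3b _ _ _ _ _) = refl , refl
  BasicMove-length (m4a _ _ _ _ _) = refl , refl
  BasicMove-length (m4b _ _ _ _ _) = refl , refl

  BasicMove-descents : BasicMove P t t' → ∀ v →
    des0 P (t ++ v) 0 ≡ false × des0 P (t ++ v) 1 ≡ true ×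
    des0 P (t' ++ v) 0 ≡ true × des0 P (t' ++ v) 1 ≡ false
  BasicMove-descents (m1 a<b b<c a≺c _ _) v =
    ⊀⇒rel (<⇒⊁ b<c) , ≺⇒rel a≺c , ≺⇒rel a≺c , ⊀⇒rel (<⇒⊁ a<b)
  BasicMove-descents (m2a _ b<c a≺c a≺b _) v =
    ⊀⇒rel (<⇒⊁ b<c) , ≺⇒rel a≺c , ≺⇒rel a≺b , ⊀⇒rel (<⇒⊁ (≺⇒< a≺c))
  BasicMove-descents (m2b a<b _ a≺c a≺b b∥c) v =
    ⊀⇒rel (proj₁ b∥c) , ≺⇒rel a≺b , ≺⇒rel a≺c , ⊀⇒rel (<⇒⊁ a<b)
  BasicMove-descents (m3a _ b<c a≺c a∥b b≺c) v =
    ⊀⇒rel (<⇒⊁ b<c) , ≺⇒rel a≺c , ≺⇒rel b≺c , ⊀⇒rel (proj₁ a∥b)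
  BasicMove-descents (m3b a<b _ a≺c _ b≺c) v =
    ⊀⇒rel (<⇒⊁ (≺⇒< a≺c)) , ≺⇒rel b≺c , ≺⇒rel a≺c , ⊀⇒rel (<⇒⊁ a<b)
  BasicMove-descents (m4a _ b<c a≺c a≺b _) v =
    ⊀⇒rel (<⇒⊁ b<c) , ≺⇒rel a≺c , ≺⇒rel a≺b , ⊀⇒rel (<⇒⊁ (≺⇒< a≺c))
  BasicMove-descents (m4b a<b _ a≺c _ b≺c) v =
    ⊀⇒rel (<⇒⊁ (≺⇒< a≺c)) , ≺⇒rel b≺c , ≺⇒rel a≺c , ⊀⇒rel (<⇒⊁ a<b)

  BasicMove-leftBoundary : BasicMove P t t' → ∀ v d →
    T (des0 P (d ∷ t' ++ v) 0) → T (des0 P (d ∷ t ++ v) 0)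
  BasicMove-leftBoundary (m1  _   b<c _ _ _) v d = <-≺-trans b<c
  BasicMove-leftBoundary (m2a _   _   _ _ _) v d = id
  BasicMove-leftBoundary (m2b _   _   _ _ _) v d = id
  BasicMove-leftBoundary (m3a _   b<c _ _ _) v d = <-≺-trans b<c
  BasicMove-leftBoundary (m3b a<b b<c _ _ _) v d = <-≺-trans (<-trans a<b b<c)
  BasicMove-leftBoundary (m4a _   _   _ _ _) v d = id
  BasicMove-leftBoundary (m4b a<b b<c _ _ _) v d = <-≺-trans (<-trans a<b b<c)

  BasicMove-rightBoundary : BasicMove P t t' → ∀ v →
    T (des0 P (t ++ v) 2) → T (des0 P (t' ++ v) 2)
  BasicMove-rightBoundary (m1  a<b _ _   _ _) = des0-< a<b
  BasicMove-rightBoundary (m2a _   _ a≺c _ _) = des0-< (≺⇒< a≺c)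
  BasicMove-rightBoundary (m2b a<b _ _   _ _) = des0-< a<b
  BasicMove-rightBoundary (m3a _   _ _   _ _) v = id
  BasicMove-rightBoundary (m3b _   _ _   _ _) v = id
  BasicMove-rightBoundary (m4a _   _ a≺c _ _) = des0-< (≺⇒< a≺c)
  BasicMove-rightBoundary (m4b _   _ _   _ _) v = id

  -- Only three-letter windows occur; the catch-all clauses are junk.
  forwardPartner backwardPartner : Word n → Word n
  forwardPartner (x ∷ y ∷ z ∷ []) =
    if rel z x then x ∷ z ∷ y ∷ [] else if rel x y then y ∷ x ∷ z ∷ [] else y ∷ z ∷ x ∷ []
  forwardPartner w = w
  backwardPartner (x ∷ y ∷ z ∷ []) =
    if rel z x then y ∷ x ∷ z ∷ [] else if rel y z then x ∷ z ∷ y ∷ [] else z ∷ x ∷ y ∷ []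
  backwardPartner w = w

  BasicMove⇒forwardPartner : BasicMove P t t' → t' ≡ forwardPartner t
  BasicMove⇒forwardPartner (m1 _ _ _ a∥b b∥c)
    rewrite ⊀⇒rel (proj₁ a∥b) | ⊀⇒rel (proj₁ b∥c) = refl
  BasicMove⇒forwardPartner (m2a _ _ _ a≺b _) rewrite ≺⇒rel a≺b = refl
  BasicMove⇒forwardPartner (m2b _ _ a≺c _ _) rewrite ≺⇒rel a≺c = refl
  BasicMove⇒forwardPartner (m3a _ _ _ a∥b b≺c)
    rewrite ⊀⇒rel (proj₁ a∥b) | ≺⇒rel b≺c = refl
  BasicMove⇒forwardPartner (m3b a<b _ a≺c _ _)
    rewrite ⊀⇒rel (<⇒⊁ a<b) | ≺⇒rel a≺c = refl
  BasicMove⇒forwardPartner (m4a _ _ _ a≺b _) rewrite ≺⇒rel a≺b = refl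
  BasicMove⇒forwardPartner (m4b a<b _ a≺c _ _)
    rewrite ⊀⇒rel (<⇒⊁ a<b) | ≺⇒rel a≺c = refl

  BasicMove⇒backwardPartner : BasicMove P t t' → t ≡ backwardPartner t'
  BasicMove⇒backwardPartner (m1 _ _ _ a∥b b∥c)
    rewrite ⊀⇒rel (proj₁ b∥c) | ⊀⇒rel (proj₁ a∥b) = refl
  BasicMove⇒backwardPartner (m2a _ b<c a≺c _ _)
    rewrite ⊀⇒rel (<⇒⊁ b<c) | ≺⇒rel a≺c = refl
  BasicMove⇒backwardPartner (m2b _ _ _ a≺b b∥c)
    rewrite ⊀⇒rel (proj₁ b∥c) | ≺⇒rel a≺b = refl
  BasicMove⇒backwardPartner (m3a _ _ a≺c _ _) rewrite ≺⇒rel a≺c = refl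
  BasicMove⇒backwardPartner (m3b _ _ _ _ b≺c) rewrite ≺⇒rel b≺c = refl
  BasicMove⇒backwardPartner (m4a _ b<c a≺c _ _)
    rewrite ⊀⇒rel (<⇒⊁ b<c) | ≺⇒rel a≺c = refl
  BasicMove⇒backwardPartner (m4b _ _ _ _ b≺c) rewrite ≺⇒rel b≺c = refl

  forwardMove : ∀ {x y z} → x ≢ y → x ≢ z → ¬ y ≺ x → z ≺ y →
                ∃ (BasicMove P (x ∷ y ∷ z ∷ []))
  forwardMove {x} {y} {z} x≢y x≢z y⊀x z≺y with <-cmp x y
  ... | tri≈ _ x≡y _ = ⊥-elim (x≢y x≡y)
  ... | tri> _ _ y<x = -, m2b (≺⇒< z≺y) y<x (≺-<-trans z≺y y<x) z≺y (y⊀x , <⇒⊁ y<x)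
  ... | tri< x<y _ _ with <-cmp x z
  ...   | tri≈ _ x≡z _ = ⊥-elim (x≢z x≡z)
  ...   | tri< x<z _ _ with T? (rel x z)
  ...     | yes x≺z = -, m4b x<z (≺⇒< z≺y) (<-≺-trans x<z z≺y) x≺z z≺y
  ...     | no  x⊀z = -, m3b x<z (≺⇒< z≺y) (<-≺-trans x<z z≺y) (x⊀z , <⇒⊁ x<z) z≺y
  forwardMove {x} {y} {z} x≢y x≢z y⊀x z≺y | tri< x<y _ _ | tri> _ _ z<x
    with T? (rel z x) | T? (rel x y)
  ... | yes z≺x | yes x≺y = -, m4a z<x x<y z≺y z≺x x≺y
  ... | yes z≺x | no  x⊀y = -, m2a z<x x<y z≺y z≺x (x⊀y , y⊀x)
  ... | no  z⊀x | yes x≺y = -, m3a z<x x<y z≺y (z⊀x , <⇒⊁ z<x) x≺y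
  ... | no  z⊀x | no  x⊀y = -, m1 z<x x<y z≺y (z⊀x , <⇒⊁ z<x) (x⊀y , y⊀x)

  backwardMove : ∀ {x y z} → y ≢ z → x ≢ z → y ≺ x → ¬ z ≺ y →
                 ∃ λ s → BasicMove P s (x ∷ y ∷ z ∷ [])
  backwardMove {x} {y} {z} y≢z x≢z y≺x z⊀y with <-cmp y z
  ... | tri≈ _ y≡z _ = ⊥-elim (y≢z y≡z)
  ... | tri> _ _ z<y = -, m3a z<y (≺⇒< y≺x) (<-≺-trans z<y y≺x) (z⊀y , <⇒⊁ z<y) y≺x
  ... | tri< y<z _ _ with <-cmp z x
  ...   | tri≈ _ z≡x _ = ⊥-elim (x≢z (sym z≡x))
  ...   | tri> _ _ x<z with T? (rel x z)
  ...     | yes x≺z = -, m4a (≺⇒< y≺x) x<z (≺-<-trans y≺x x<z) y≺x x≺z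
  ...     | no  x⊀z = -, m2a (≺⇒< y≺x) x<z (≺-<-trans y≺x x<z) y≺x (x⊀z , <⇒⊁ x<z)
  backwardMove {x} {y} {z} y≢z x≢z y≺x z⊀y | tri< y<z _ _ | tri< z<x _ _
    with T? (rel y z) | T? (rel z x)
  ... | yes y≺z | yes z≺x = -, m4b y<z z<x y≺x y≺z z≺x
  ... | yes y≺z | no  z⊀x = -, m2b y<z z<x y≺x y≺z (z⊀x , <⇒⊁ z<x)
  ... | no  y⊀z | yes z≺x = -, m3b y<z z<x y≺x (y⊀z , z⊀y) z≺x
  ... | no  y⊀z | no  z⊀x = -, m1 y<z z<x y≺x (y⊀z , z⊀y) (z⊀x , <⇒⊁ z<x)

  Move3-length : Move3 P t t' → length t ≡ 3
  Move3-length (inj₁ m) = proj₁ (BasicMove-length m)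
  Move3-length (inj₂ m) = proj₂ (BasicMove-length m)

  Move3-oneDescent : Move3 P t t' → ∀ v → (des0 P (t ++ v) 0 xor des0 P (t ++ v) 1) ≡ true
  Move3-oneDescent (inj₁ m) v with d₀ , d₁ , _ ← BasicMove-descents m v = cong₂ _xor_ d₀ d₁
  Move3-oneDescent (inj₂ m) v with _ , _ , d₀ , d₁ ← BasicMove-descents m v = cong₂ _xor_ d₀ d₁

  Move3-flips : Move3 P t t' → ∀ v → des0 P (t ++ v) 1 ≢ des0 P (t' ++ v) 1
  Move3-flips (inj₁ m) v with _ , d , _ , d′ ← BasicMove-descents m v =
    subst₂ _≢_ (sym d) (sym d′) λ ()
  Move3-flips (inj₂ m) v with _ , d , _ , d′ ← BasicMove-descents m v =
    subst₂ _≢_ (sym d′) (sym d) λ ()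

  BasicMove-source≢target : ∀ {t₁ t₂} → BasicMove P t t₁ → ¬ BasicMove P t₂ t
  BasicMove-source≢target m m′
    with d₀ , _ ← BasicMove-descents m [] | _ , _ , d₀′ , _ ← BasicMove-descents m′ []
    with () ← trans (sym d₀) d₀′

  Move3-functional : ∀ {t₁ t₂} → Move3 P t t₁ → Move3 P t t₂ → t₁ ≡ t₂
  Move3-functional (inj₁ m) (inj₁ m') =
    trans (BasicMove⇒forwardPartner m) (sym (BasicMove⇒forwardPartner m'))
  Move3-functional (inj₂ m) (inj₂ m') =
    trans (BasicMove⇒backwardPartner m) (sym (BasicMove⇒backwardPartner m'))
  Move3-functional (inj₁ m) (inj₂ m') = ⊥-elim (BasicMove-source≢target m m')
  Move3-functional (inj₂ m) (inj₁ m') = ⊥-elim (BasicMove-source≢target m' m)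

  Move3-exists : x ≢ y → y ≢ z → x ≢ z → (rel y x xor rel z y) ≡ true →
                 ∃ (Move3 P (x ∷ y ∷ z ∷ []))
  Move3-exists {x} {y} {z} x≢y y≢z x≢z one with rel y x in yx | rel z y in zy
  ... | true  | false = -, inj₂ (proj₂ (backwardMove y≢z x≢z (rel⇒≺ yx) (subst T zy)))
  ... | false | true  = -, inj₁ (proj₂ (forwardMove x≢y x≢z (subst T yx) (rel⇒≺ zy)))


  des0-shift : ∀ u w k → des0 P (u ++ w) (k + length u) ≡ des0 P w k
  des0-shift []      w k = cong (des0 P w) (+-identityʳ k)
  des0-shift (a ∷ u) w k = begin
    des0 P (a ∷ u ++ w) (k + suc (length u)) ≡⟨ cong (des0 P (a ∷ u ++ w)) (+-suc k (length u)) ⟩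
    des0 P (a ∷ u ++ w) (suc (k + length u)) ≡⟨ des0-cons a (u ++ w) (k + length u) ⟩
    des0 P (u ++ w) (k + length u)           ≡⟨ des0-shift u w k ⟩
    des0 P w k                               ∎
    where open ≡-Reasoning

  des0-prefix : ∀ u {r r'} k → 2 + k ≤ length u → des0 P (u ++ r) k ≡ des0 P (u ++ r') k
  des0-prefix (a ∷ b ∷ u) zero    _         = refl
  des0-prefix (a ∷ b ∷ u) (suc k) (s≤s len) = des0-prefix (b ∷ u) k len
  des0-prefix (a ∷ [])    k       (s≤s ())

  des0-beyond : ∀ (w w' : Word n) {v} k → length w ≡ length w' → length w ≤ k →
                des0 P (w ++ v) k ≡ des0 P (w' ++ v) k
  des0-beyond []      []        k       _   _         = refl
  des0-beyond (a ∷ w) (a' ∷ w') {v} (suc k) len (s≤s k≥) = begin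
    des0 P (a ∷ w ++ v) (suc k)   ≡⟨ des0-cons a (w ++ v) k ⟩
    des0 P (w ++ v) k             ≡⟨ des0-beyond w w' k (suc-injective len) k≥ ⟩
    des0 P (w' ++ v) k            ≡⟨ des0-cons a' (w' ++ v) k ⟨
    des0 P (a' ∷ w' ++ v) (suc k) ∎
    where open ≡-Reasoning

  desP-boundary : ∀ u {r r'} → (∀ d → T (des0 P (d ∷ r) 0) → T (des0 P (d ∷ r') 0)) →
                  T (desP P (u ++ r) (length u)) → T (desP P (u ++ r') (length u))
  desP-boundary []          _      ()
  desP-boundary (a ∷ [])    r⇒r' = r⇒r' a
  desP-boundary (a ∷ b ∷ u) r⇒r' = desP-boundary (b ∷ u) r⇒r'

  des0-length : ∀ (w : Word n) k → des0 P w k ≡ true → 2 + k ≤ length w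
  des0-length (a ∷ b ∷ w) zero    _ = s≤s (s≤s z≤n)
  des0-length (a ∷ w)     (suc k) d = s≤s (des0-length w k (trans (sym (des0-cons a w k)) d))

  -- KnuthAt with the position written as 2 + length u, so that i ∸ 1 and i ∸ 2 compute.
  data KnuthMove : ℕ → Word n → Word n → Set where
    move : ∀ u {t t'} v → Move3 P t t' → KnuthMove (2 + length u) (u ++ t ++ v) (u ++ t' ++ v)

  KnuthAt⇒KnuthMove : ∀ {i w x} → KnuthAt P i w x → KnuthMove i w x
  KnuthAt⇒KnuthMove (u , v , t , t' , refl , refl , refl , m) =
    subst (λ i → KnuthMove i (u ++ t ++ v) (u ++ t' ++ v)) (+-comm 2 (length u)) (move u v m)

  KnuthMove⇒KnuthAt : ∀ {i w x} → KnuthMove i w x → KnuthAt P i w x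
  KnuthMove⇒KnuthAt (move u v m) = u , v , _ , _ , refl , refl , +-comm 2 (length u) , m

  KnuthMove-cons : ∀ {i w x} a → KnuthMove i w x → KnuthMove (suc i) (a ∷ w) (a ∷ x)
  KnuthMove-cons a (move u v m) = move (a ∷ u) v m

  KnuthMove-oneDescent : ∀ {i w x} → KnuthMove i w x → (desP P w (i ∸ 1) xor desP P w i) ≡ true
  KnuthMove-oneDescent (move u v m) =
    trans (cong₂ _xor_ (des0-shift u _ 0) (des0-shift u _ 1)) (Move3-oneDescent m v)

  KnuthMove-flips : ∀ {i w x} → KnuthMove i w x → desP P w i ≢ desP P x i
  KnuthMove-flips (move u v m) =
    subst₂ _≢_ (sym (des0-shift u _ 1)) (sym (des0-shift u _ 1)) (Move3-flips m v)

  KnuthMove-far : ∀ {i w x} → KnuthMove i w x →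
                  ∀ h → h < i ∸ 2 ⊎ i + 1 < h → desP P w h ≡ desP P x h
  KnuthMove-far (move u v m) zero    _         = refl
  KnuthMove-far (move u v m) (suc k) (inj₁ h<) = des0-prefix u k h<
  KnuthMove-far (move u {t} {t'} v m) (suc k) (inj₂ h>) = begin
    des0 P (u ++ t ++ v) k    ≡⟨ cong (λ w → des0 P w k) (++-assoc u t v) ⟨
    des0 P ((u ++ t) ++ v) k  ≡⟨ des0-beyond (u ++ t) (u ++ t') k (trans len-t (sym len-t'))
                                   (subst (_≤ k) (sym len-t) (s≤s⁻¹ h>)) ⟩
    des0 P ((u ++ t') ++ v) k ≡⟨ cong (λ w → des0 P w k) (++-assoc u t' v) ⟩
    des0 P (u ++ t' ++ v) k   ∎
    where
    open ≡-Reasoning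
    length-u++ : ∀ s → length s ≡ 3 → length (u ++ s) ≡ 2 + length u + 1
    length-u++ s s≡3 = begin
      length (u ++ s)     ≡⟨ length-++ u ⟩
      length u + length s ≡⟨ cong (length u +_) s≡3 ⟩
      length u + 3        ≡⟨ +-comm (length u) 3 ⟩
      3 + length u        ≡⟨ +-comm 1 (2 + length u) ⟩
      2 + length u + 1    ∎
    len-t  = length-u++ t (Move3-length m)
    len-t' = length-u++ t' (Move3-length (Sum.swap m))

  KnuthMove-leftBoundary : ∀ {i w x} → KnuthMove i w x → desP P w (i ∸ 2) ≢ desP P x (i ∸ 2) →
                           (desP P w (i ∸ 2) xor desP P w (i ∸ 1)) ≡ true
  KnuthMove-leftBoundary (move u v (inj₁ m)) σ≢
    with d₀ , _ ← BasicMove-descents m v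
    with _ , σw≡true ← T-mono-≢ (desP-boundary u (BasicMove-leftBoundary m v)) (≢-sym σ≢)
    = cong₂ _xor_ σw≡true (trans (des0-shift u _ 0) d₀)
  KnuthMove-leftBoundary (move u v (inj₂ m)) σ≢
    with _ , _ , d₀ , _ ← BasicMove-descents m v
    with σw≡false , _ ← T-mono-≢ (desP-boundary u (BasicMove-leftBoundary m v)) σ≢
    = cong₂ _xor_ σw≡false (trans (des0-shift u _ 0) d₀)

  KnuthMove-rightBoundary : ∀ {i w x} → KnuthMove i w x → desP P w (i + 1) ≢ desP P x (i + 1) →
                            (desP P w i xor desP P w (i + 1)) ≡ true
  KnuthMove-rightBoundary (move u {t} {t'} v m) σ≢ =
    right m (subst₂ _≢_ (σ-after t) (σ-after t') σ≢)
    where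
    σ-after : ∀ s → desP P (u ++ s ++ v) (2 + length u + 1) ≡ des0 P (s ++ v) 2
    σ-after s =
      trans (cong (desP P (u ++ s ++ v)) (+-comm (2 + length u) 1)) (des0-shift u (s ++ v) 2)
    right : Move3 P t t' → des0 P (t ++ v) 2 ≢ des0 P (t' ++ v) 2 →
            (desP P (u ++ t ++ v) (2 + length u) xor desP P (u ++ t ++ v) (2 + length u + 1)) ≡ true
    right (inj₁ m) σ≢′
      with _ , d₁ , _ ← BasicMove-descents m v
      with σw≡false , _ ← T-mono-≢ (BasicMove-rightBoundary m v) σ≢′
      = cong₂ _xor_ (trans (des0-shift u _ 1) d₁) (trans (σ-after t) σw≡false)
    right (inj₂ m) σ≢′
      with _ , _ , _ , d₁ ← BasicMove-descents m v
      with _ , σw≡true ← T-mono-≢ (BasicMove-rightBoundary m v) (≢-sym σ≢′)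
      = cong₂ _xor_ (trans (des0-shift u _ 1) d₁) (trans (σ-after t) σw≡true)

  KnuthMove-exists : ∀ (w : Word n) k → Unique w → 3 + k ≤ length w →
                     (desP P w (suc k) xor desP P w (2 + k)) ≡ true → ∃ (KnuthMove (2 + k) w)
  KnuthMove-exists (x ∷ y ∷ z ∷ v) zero ((x≢y ∷ x≢z ∷ _) ∷ (y≢z ∷ _) ∷ _) _ one =
    -, move [] v (proj₂ (Move3-exists x≢y y≢z x≢z one))
  KnuthMove-exists (x ∷ y ∷ []) zero _ (s≤s (s≤s ()))
  KnuthMove-exists (a ∷ w) (suc k) (_ ∷ w-unique) (s≤s len) one =
    -, KnuthMove-cons a (proj₂ (KnuthMove-exists w k w-unique len one′))
    where
    one′ = trans (cong₂ _xor_ (sym (des0-cons a w k)) (sym (des0-cons a w (suc k)))) one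

  KnuthAt-sym : ∀ {i w x} → KnuthAt P i w x → KnuthAt P i x w
  KnuthAt-sym (u , v , t , t' , w≡ , x≡ , i≡ , m) = u , v , t' , t , x≡ , w≡ , i≡ , Sum.swap m

  KnuthAt-functional : ∀ {i w x y} → KnuthAt P i w x → KnuthAt P i w y → x ≡ y
  KnuthAt-functional (u₁ , v₁ , t₁ , _ , refl , refl , refl , m₁)
                     (u₂ , v₂ , t₂ , _ , w≡ , refl , i≡ , m₂)
    with refl , w≡′ ← ++-cancel-length u₁ u₂ (+-cancelʳ-≡ 2 _ _ i≡) w≡
    with refl , refl ← ++-cancel-length t₁ t₂ (trans (Move3-length m₁) (sym (Move3-length m₂))) w≡′
    = cong (λ t → u₁ ++ t ++ v₁) (Move3-functional m₁ m₂)

  KnuthAt-commute : ∀ {i j w x y} → i + 3 ≤ j → KnuthAt P i w x → KnuthAt P j x y →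
                    ∃ λ z → KnuthAt P j w z × KnuthAt P i z y
  KnuthAt-commute i+3≤j (u , v , t , t' , refl , refl , refl , m)
                        (u₂ , v₂ , s , s' , x≡ , refl , refl , m₂)
    with r , refl , refl ← ++-split-≤ (u ++ t') v u₂ (s ++ v₂) (trans (++-assoc u t' v) x≡)
                             (window-before u t' (Move3-length (Sum.swap m)) i+3≤j)
    = u ++ t ++ r ++ s' ++ v₂ , w–z , z–y
    where
    w–z : KnuthAt P (length ((u ++ t') ++ r) + 2) (u ++ t ++ r ++ s ++ v₂) (u ++ t ++ r ++ s' ++ v₂)
    w–z = u ++ t ++ r , v₂ , s , s' , ++-assoc₃ u t r (s ++ v₂) , ++-assoc₃ u t r (s' ++ v₂)
        , cong (_+ 2) (length-++-≡ u r (trans (Move3-length (Sum.swap m)) (sym (Move3-length m))))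
        , m₂
    z–y : KnuthAt P (length u + 2) (u ++ t ++ r ++ s' ++ v₂) (((u ++ t') ++ r) ++ s' ++ v₂)
    z–y = u , r ++ s' ++ v₂ , t , t' , refl
        , trans (++-assoc (u ++ t') r (s' ++ v₂)) (++-assoc u t' (r ++ s' ++ v₂))
        , refl , m

  KnuthAt-commute-far : ∀ {i j w x y} → i + 3 ≤ j ⊎ j + 3 ≤ i → KnuthAt P i w x → KnuthAt P j x y →
                        ∃ λ z → KnuthAt P j w z × KnuthAt P i z y
  KnuthAt-commute-far (inj₁ i+3≤j) w–x x–y = KnuthAt-commute i+3≤j w–x x–y
  KnuthAt-commute-far (inj₂ j+3≤i) w–x x–y
    with z , y–z , z–w ← KnuthAt-commute j+3≤i (KnuthAt-sym x–y) (KnuthAt-sym w–x)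
    = z , KnuthAt-sym z–w , KnuthAt-sym y–z

InSn⇒length : ∀ {n w} → InSn n w → length w ≡ n
InSn⇒length {n} w↭ = trans (↭-length w↭) (length-tabulate id)

InSn⇒Unique : ∀ {n w} → InSn n w → Unique w
InSn⇒Unique {n} w↭ = Unique-resp-↭ (setoid (Fin n)) (↭⇒↭ₛ (↭-sym w↭)) (allFin⁺ n)

module _ {n : ℕ} (P : NUIO n) (V : Word n → Set) where
  module Γ = SignedColoredGraph (Γ P V)

  Γ-isSignedColoredGraph : (∀ w → V w → InSn n w) → IsSignedColoredGraph (Γ P V)
  Γ-isSignedColoredGraph perm = bounded , edge , symmetric
    where
    bounded : ∀ w j → V w → desP P w j ≡ true → 1 ≤ j × j ≤ n ∸ 1
    bounded w (suc k) vw d =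
      s≤s z≤n
      , subst (λ l → suc k ≤ l ∸ 1) (InSn⇒length (perm w vw)) (∸-monoˡ-≤ 1 (des0-length P w k d))
    edge : ∀ i w x → Γ.E i w x → V w × V x × w ≢ x × 1 < i × i < n
    edge i w x (vw , vx , 1<i , i<n , w–x) =
      vw , vx , (λ w≡x → KnuthMove-flips P (KnuthAt⇒KnuthMove P w–x) (cong (λ w → desP P w i) w≡x))
         , 1<i , i<n
    symmetric : ∀ i w x → Γ.E i w x → Γ.E i x w
    symmetric i w x (vw , vx , 1<i , i<n , w–x) = vx , vw , 1<i , i<n , KnuthAt-sym P w–x

  Γ-ax1 : (∀ w → V w → InSn n w) → ClosedUnderKnuth P V → Ax1 (Γ P V)
  Γ-ax1 perm closed w (suc (suc k)) vw (s≤s (s≤s z≤n)) i<n = (exists , oneDescent) , functional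
    where
    exists : (desP P w (suc k) xor desP P w (2 + k)) ≡ true → ∃ λ x → V x × Γ.E (2 + k) w x
    exists one
      with x , w–x ← KnuthMove-exists P w k (InSn⇒Unique (perm w vw))
                       (subst (3 + k ≤_) (sym (InSn⇒length (perm w vw))) i<n) one
      = x , vx , vw , vx , s≤s (s≤s z≤n) , i<n , KnuthMove⇒KnuthAt P w–x
      where vx = closed (2 + k) w x vw (KnuthMove⇒KnuthAt P w–x)
    oneDescent : (∃ λ x → V x × Γ.E (2 + k) w x) → (desP P w (suc k) xor desP P w (2 + k)) ≡ true
    oneDescent (_ , _ , _ , _ , _ , _ , w–x) = KnuthMove-oneDescent P (KnuthAt⇒KnuthMove P w–x)
    functional : ∀ x y → Γ.E (2 + k) w x → Γ.E (2 + k) w y → x ≡ y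
    functional x y (_ , _ , _ , _ , w–x) (_ , _ , _ , _ , w–y) = KnuthAt-functional P w–x w–y

  Γ-ax2 : Ax2 (Γ P V)
  Γ-ax2 i w x (_ , _ , _ , _ , w–x) = KnuthMove-flips P w–x′ , KnuthMove-far P w–x′
    where w–x′ = KnuthAt⇒KnuthMove P w–x

  Γ-ax3 : Ax3 (Γ P V)
  Γ-ax3 i w x (_ , _ , _ , _ , w–x) = KnuthMove-leftBoundary P w–x′ , KnuthMove-rightBoundary P w–x′
    where w–x′ = KnuthAt⇒KnuthMove P w–x

  Γ-ax5 : ClosedUnderKnuth P V → Ax5 (Γ P V)
  Γ-ax5 closed i j w x y far (vw , _ , 1<i , i<n , w–x) (_ , vy , 1<j , j<n , x–y)
    with z , w–z , z–y ← KnuthAt-commute-far P far w–x x–y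
    = z , vz , (vw , vz , 1<j , j<n , w–z) , (vz , vy , 1<i , i<n , z–y)
    where vz = closed j w z vw w–z

proposition4p9 : (n : ℕ) (P : NUIO n) (V : List (Fin n) → Set) →
                 (∀ w → V w → InSn n w) →
                 ClosedUnderKnuth P V →
                 IsDGraph (Γ P V)
proposition4p9 n P V perm closed =
  Γ-isSignedColoredGraph P V perm , Γ-ax1 P V perm closed , Γ-ax2 P V , Γ-ax3 P V , Γ-ax5 P V closed
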